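{- There are constants $c_1,c_2>0$ such that for all sufficiently large $n$ there exist partitions $\lambda,\mu,\nu\vdash n$ with $$e^{c_1 n^{2/3}}\le \mathrm{Pyr}(\lambda,\mu,\nu)\le e^{c_2 n^{2/3}},$$ i.e. $\mathrm{Pyr}(\lambda,\mu,\nu)=\exp\Theta(n^{2/3})$.
   Context: For $\lambda,\mu,\nu\vdash n$, a pyramid with margins $(\lambda,\mu,\nu)$ is an array $(x_{ijk})$ with entries in $\{0,1\}$, $1\le i\le\ell(\lambda)$, $1\le j\le\ell(\mu)$, $1\le k\le\ell(\nu)$, with $\sum_{j,k}x_{ijk}=\lambda_i$, $\sum_{i,k}x_{ijk}=\mu_j$, $\sum_{i,j}x_{ijk}=\nu_k$, and such that $x_{ijk}=1$ implies $x_{pqs}=1$ for all $p\le i$, $q\le j$, $s\le k$. $\mathrm{Pyr}(\lambda,\mu,\nu)$ is the number of such pyramids; $\ell(\cdot)$ is number of parts. -}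

module Defs where

open import Data.Bool using (Bool; true; false)
open import Data.Nat using (ℕ; zero; suc; _+_; _<_; _≥_)
import Data.Nat as ℕ
import Data.Fin as Fin
open import Data.Fin using (Fin; _≤_; _≤?_)
open import Data.Fin.Properties using (all?)
open import Data.List using (List; []; _∷_; length; lookup; map; concatMap; filter)
open import Data.Nat.ListAction using (sum)
open import Data.List.Relation.Unary.All using (All)
open import Data.List.Relation.Unary.Linked using (Linked)
open import Data.Vec using (Vec; []; _∷_) renaming (lookup to vlookup)
open import Data.Product using (_×_; _,_)
open import Relation.Binary.PropositionalEquality using (_≡_)
open import Relation.Nullary using (Dec)
open import Relation.Nullary.Decidable using (_×-dec_; _→-dec_)
import Data.Bool.Properties as BP

IsPartition : ℕ → List ℕ → Set
IsPartition n l = (sum l ≡ n) × Linked _≥_ l × All (λ x → 0 < x) l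

sumFin : (n : ℕ) → (Fin n → ℕ) → ℕ
sumFin zero    f = 0
sumFin (suc n) f = f Fin.zero + sumFin n (λ i → f (Fin.suc i))

val : Bool → ℕ
val true  = 1
val false = 0

Arr : ℕ → ℕ → ℕ → Set
Arr a b c = Vec (Vec (Vec Bool c) b) a

entry : ∀ {a b c} → Arr a b c → Fin a → Fin b → Fin c → Bool
entry x i j k = vlookup (vlookup (vlookup x i) j) k

IsPyramid : (la mu nu : List ℕ) → Arr (length la) (length mu) (length nu) → Set
IsPyramid la mu nu x =
  (∀ i → sumFin _ (λ j → sumFin _ (λ k → val (entry x i j k))) ≡ lookup la i) ×
  (∀ j → sumFin _ (λ i → sumFin _ (λ k → val (entry x i j k))) ≡ lookup mu j) ×
  (∀ k → sumFin _ (λ i → sumFin _ (λ j → val (entry x i j k))) ≡ lookup nu k) ×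
  (∀ i j k p q s → p ≤ i → q ≤ j → s ≤ k → entry x i j k ≡ true → entry x p q s ≡ true)

isPyramid? : (la mu nu : List ℕ) → (x : Arr (length la) (length mu) (length nu)) → Dec (IsPyramid la mu nu x)
isPyramid? la mu nu x =
  all? (λ i → _ ℕ.≟ _) ×-dec
  (all? (λ j → _ ℕ.≟ _) ×-dec
  (all? (λ k → _ ℕ.≟ _) ×-dec
  all? (λ i → all? (λ j → all? (λ k → all? (λ p → all? (λ q → all? (λ s →
    (p ≤? i) →-dec ((q ≤? j) →-dec ((s ≤? k) →-dec
      ((entry x i j k BP.≟ true) →-dec (entry x p q s BP.≟ true))))))))))))

allVec : ∀ {A : Set} → List A → (n : ℕ) → List (Vec A n)
allVec xs zero    = [] ∷ []
allVec xs (suc n) = concatMap (λ x → map (x ∷_) (allVec xs n)) xs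

allArr : (a b c : ℕ) → List (Arr a b c)
allArr a b c = allVec (allVec (allVec (true ∷ false ∷ []) c) b) a

Pyr : List ℕ → List ℕ → List ℕ → ℕ
Pyr la mu nu = length (filter (isPyramid? la mu nu) (allArr (length la) (length mu) (length nu)))

module Submission where

-- Upper bound, valid for all margins: fixing the first index i, a pyramid is a
-- down-closed subset of an ℓ(μ) × ℓ(ν) box, determined by its boundary path of
-- ℓ(μ) + ℓ(ν) steps; hence Pyr(λ, μ, ν) ≤ 2^{ℓ(λ)(ℓ(μ) + ℓ(ν))}.
--
-- Lower bound, by a construction: the solid diagram of a plane partition h in
-- an A × M box is a pyramid whose margins are the row sums, column sums and layer
-- sizes of h.  Cut the M × M box (M = 3K) into K² blocks of size 3 × 3, raise the
-- blocks along a staircase of offsets, and fill each block with one of two 3 × 3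
-- patterns having equal row sums, column sums and multisets of entries.  All 2^{K²}
-- choices give distinct pyramids with the same margins.  A constant lift and a
-- few padding rows make the volume exactly n.
--
-- Choosing 91 K³ ≤ n < 91 (K + 1)³ yields 2^{K²} ≤ Pyr ≤ 2^{564 K²}, i.e. the
-- constants a = 81, b = 564 and N = 91 of the statement.

open import Defs
open import Data.Bool using (Bool; true; false; if_then_else_; T)
open import Data.Unit using (tt)
open import Data.Empty using (⊥-elim)
open import Data.Nat using (ℕ; zero; suc; _+_; _*_; _^_; _∸_; _≤_; _<_; _≥_; z≤n; s≤s; z<s; s<s; _<ᵇ_; _≤ᵇ_; _/_; _%_; NonZero)
open import Data.Nat.DivMod using (m≡m%n+[m/n]*n; m%n<n; m/n*n≤m; m<n*o⇒m/o<n)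
open import Data.Nat.Properties
open import Data.Nat.ListAction using (sum)
open import Data.Nat.Tactic.RingSolver using (solve-∀)
open import Data.List using (List; []; _∷_; length; map; filter; _++_; replicate; cartesianProductWith; [_])
import Data.List as List
open import Data.List.Properties using (length-++; length-map; length-replicate; ∷-injectiveʳ)
open import Data.List.Membership.Propositional using (_∈_)
open import Data.List.Membership.Propositional.Properties
  using (∈-++⁻; ∈-++⁺ˡ; ∈-++⁺ʳ; ∈-∃++; ∈-map⁺; ∈-filter⁺; ∈-filter⁻; ∈-cartesianProductWith⁺)
open import Data.List.Relation.Unary.Any using (here; there)
open import Data.List.Relation.Unary.All using (All; []; _∷_)
import Data.List.Relation.Unary.All as All
open import Data.List.Relation.Unary.AllPairs using ([]; _∷_)
open import Data.List.Relation.Unary.Linked using (Linked; []; [-]; _∷_)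
open import Data.List.Relation.Unary.Unique.Propositional using (Unique)
import Data.List.Relation.Unary.Unique.Propositional.Properties as Unique
open import Data.Vec using (Vec; []; _∷_; lookup; tabulate)
import Data.Vec as Vec
open import Data.Vec.Properties using (lookup∘tabulate)
open import Data.Fin using (Fin; toℕ; fromℕ; fromℕ<; inject₁)
import Data.Fin as Fin
open import Data.Fin.Properties using (toℕ<n; toℕ-fromℕ<; ≤fromℕ; toℕ-inject₁)
open import Data.Product using (Σ; _×_; _,_; proj₁; proj₂)
open import Data.Sum using (_⊎_; inj₁; inj₂)
open import Relation.Binary.PropositionalEquality hiding ([_])
open import Relation.Nullary using (Dec; yes; no)

allVec-cartesian : ∀ {A : Set} (xs : List A) n →
  allVec xs (suc n) ≡ cartesianProductWith _∷_ xs (allVec xs n)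
allVec-cartesian xs n = go xs
  where
  go : ∀ zs → List.concatMap (λ x → map (x ∷_) (allVec xs n)) zs
            ≡ cartesianProductWith _∷_ zs (allVec xs n)
  go []       = refl
  go (x ∷ zs) = cong (map (x ∷_) (allVec xs n) ++_) (go zs)

length-cartesianProductWith : ∀ {A B C : Set} (f : A → B → C) xs ys →
  length (cartesianProductWith f xs ys) ≡ length xs * length ys
length-cartesianProductWith f []       ys = refl
length-cartesianProductWith f (x ∷ xs) ys = begin
  length (map (f x) ys ++ cartesianProductWith f xs ys)
    ≡⟨ length-++ (map (f x) ys) ⟩
  length (map (f x) ys) + length (cartesianProductWith f xs ys)
    ≡⟨ cong₂ _+_ (length-map (f x) ys) (length-cartesianProductWith f xs ys) ⟩
  length ys + length xs * length ys ∎
  where open ≡-Reasoning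

length-allVec : ∀ {A : Set} (xs : List A) n → length (allVec xs n) ≡ length xs ^ n
length-allVec xs zero    = refl
length-allVec xs (suc n) rewrite allVec-cartesian xs n =
  trans (length-cartesianProductWith _∷_ xs (allVec xs n)) (cong (length xs *_) (length-allVec xs n))

allVec-unique : ∀ {A : Set} (xs : List A) n → Unique xs → Unique (allVec xs n)
allVec-unique xs zero    u = [] ∷ []
allVec-unique xs (suc n) u rewrite allVec-cartesian xs n =
  Unique.cartesianProductWith⁺ _∷_ ∷-injective u (allVec-unique xs n u)
  where
  ∷-injective : ∀ {A : Set} {n} {w x : A} {y z : Vec A n} → w ∷ y ≡ x ∷ z → w ≡ x × y ≡ z
  ∷-injective refl = refl , refl

∈-allVec : ∀ {A : Set} (xs : List A) n (v : Vec A n) → (∀ i → lookup v i ∈ xs) → v ∈ allVec xs n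
∈-allVec xs zero    []      h = here refl
∈-allVec xs (suc n) (x ∷ v) h rewrite allVec-cartesian xs n =
  ∈-cartesianProductWith⁺ _∷_ (h Fin.zero) (∈-allVec xs n v (λ i → h (Fin.suc i)))

bools : List Bool
bools = true ∷ false ∷ []

bools-unique : Unique bools
bools-unique = ((λ ()) ∷ []) ∷ ([] ∷ [])

∈-bools : ∀ b → b ∈ bools
∈-bools true  = here refl
∈-bools false = there (here refl)

allArr-unique : ∀ a b c → Unique (allArr a b c)
allArr-unique a b c = allVec-unique _ a (allVec-unique _ b (allVec-unique _ c bools-unique))

∈-allArr : ∀ {a b c} (x : Arr a b c) → x ∈ allArr a b c
∈-allArr {a} {b} {c} x = ∈-allVec _ a x (λ i → ∈-allVec _ b _ (λ j → ∈-allVec _ c _ (λ k → ∈-bools _)))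

length-≤-injection : ∀ {A B : Set} (f : A → B) (xs : List A) (ys : List B) → Unique xs →
  (∀ {x y} → x ∈ xs → y ∈ xs → f x ≡ f y → x ≡ y) → (∀ {x} → x ∈ xs → f x ∈ ys) →
  length xs ≤ length ys
length-≤-injection f []       ys u inj into = z≤n
length-≤-injection f (x ∷ xs) ys (x∉xs ∷ u) inj into with ∈-∃++ (into (here refl))
... | ys₁ , ys₂ , refl = subst (suc (length xs) ≤_) (sym length-removed) (s≤s rest)
  where
  -- ys is ys₁ ++ [ f x ] ++ ys₂; the images of xs avoid f x, so they land in ys₁ ++ ys₂.
  length-removed : length (ys₁ ++ [ f x ] ++ ys₂) ≡ suc (length (ys₁ ++ ys₂))
  length-removed = trans (length-++ ys₁)
    (trans (+-suc (length ys₁) (length ys₂)) (cong suc (sym (length-++ ys₁))))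
  avoid : ∀ {y} → y ∈ xs → f y ∈ ys₁ ++ ys₂
  avoid {y} y∈xs with ∈-++⁻ ys₁ (into (there y∈xs))
  ... | inj₁ p         = ∈-++⁺ˡ p
  ... | inj₂ (here p)  = ⊥-elim (All.lookup x∉xs y∈xs (inj (here refl) (there y∈xs) (sym p)))
  ... | inj₂ (there p) = ∈-++⁺ʳ ys₁ p
  rest : length xs ≤ length (ys₁ ++ ys₂)
  rest = length-≤-injection f xs (ys₁ ++ ys₂) u (λ a b e → inj (there a) (there b) e) avoid

Pyr-≤ : ∀ la mu nu {B : Set} (code : Arr (length la) (length mu) (length nu) → B) (ys : List B) →
  (∀ x y → IsPyramid la mu nu x → IsPyramid la mu nu y → code x ≡ code y → x ≡ y) →
  (∀ x → IsPyramid la mu nu x → code x ∈ ys) → Pyr la mu nu ≤ length ys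
Pyr-≤ la mu nu code ys inj into =
  length-≤-injection code pyramids ys (Unique.filter⁺ pyr? {xs = arrays} (allArr-unique _ _ _))
    (λ {x} {y} x∈ y∈ → inj x y (isPyr x∈) (isPyr y∈)) (λ {x} x∈ → into x (isPyr x∈))
  where
  pyr? : ∀ x → Dec (IsPyramid la mu nu x)
  pyr? = isPyramid? la mu nu
  arrays pyramids : List (Arr (length la) (length mu) (length nu))
  arrays = allArr (length la) (length mu) (length nu)
  pyramids = filter pyr? arrays
  isPyr : ∀ {x} → x ∈ pyramids → IsPyramid la mu nu x
  isPyr x∈ = proj₂ (∈-filter⁻ pyr? {xs = arrays} x∈)

Pyr-≥ : ∀ la mu nu {A : Set} (pyr : A → Arr (length la) (length mu) (length nu)) (xs : List A) →
  Unique xs → (∀ {a b} → pyr a ≡ pyr b → a ≡ b) → (∀ a → IsPyramid la mu nu (pyr a)) →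
  length xs ≤ Pyr la mu nu
Pyr-≥ la mu nu pyr xs u inj isPyr =
  length-≤-injection pyr xs _ u (λ _ _ → inj) (λ {a} _ → ∈-filter⁺ (isPyramid? la mu nu) (∈-allArr (pyr a)) (isPyr a))

DownClosed : ∀ {B C} → (Fin B → Fin C → Bool) → Set
DownClosed {B} {C} S = ∀ j k q s → q Fin.≤ j → s Fin.≤ k → S j k ≡ true → S q s ≡ true

choose : Bool → List Bool → List Bool → List Bool
choose true  a b = true ∷ a
choose false a b = false ∷ b

-- The boundary path of a staircase, walked from the corner (last row, first
-- column): `true` steps right (the corner cell is full, so drop the first
-- column), `false` steps up (the corner cell is empty, so drop the last row).
staircaseCode : (B C : ℕ) → (Fin B → Fin C → Bool) → List Bool
staircaseCode zero    C       S = replicate C false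
staircaseCode (suc B) zero    S = replicate (suc B) false
staircaseCode (suc B) (suc C) S =
  choose (S (fromℕ B) Fin.zero)
    (staircaseCode (suc B) C (λ j k → S j (Fin.suc k)))
    (staircaseCode B (suc C) (λ j k → S (inject₁ j) k))

length-staircaseCode : ∀ B C S → length (staircaseCode B C S) ≡ B + C
length-staircaseCode zero    C       S = length-replicate C
length-staircaseCode (suc B) zero    S = trans (length-replicate (suc B)) (sym (+-identityʳ (suc B)))
length-staircaseCode (suc B) (suc C) S with S (fromℕ B) Fin.zero
... | true  = cong suc (trans (length-staircaseCode (suc B) C _) (sym (+-suc B C)))
... | false = cong suc (length-staircaseCode B (suc C) _)

fin-last : ∀ {B} (j : Fin (suc B)) → j ≡ fromℕ B ⊎ Σ (Fin B) λ j' → j ≡ inject₁ j'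
fin-last {zero}  Fin.zero    = inj₁ refl
fin-last {suc B} Fin.zero    = inj₂ (Fin.zero , refl)
fin-last {suc B} (Fin.suc j) with fin-last j
... | inj₁ e        = inj₁ (cong Fin.suc e)
... | inj₂ (j' , e) = inj₂ (Fin.suc j' , cong Fin.suc e)

dropColumn : ∀ {B C} {S : Fin B → Fin (suc C) → Bool} → DownClosed S → DownClosed (λ j k → S j (Fin.suc k))
dropColumn d j k q s q≤j s≤k = d j (Fin.suc k) q (Fin.suc s) q≤j (s≤s s≤k)

dropRow : ∀ {B C} {S : Fin (suc B) → Fin C → Bool} → DownClosed S → DownClosed (λ j k → S (inject₁ j) k)
dropRow d j k q s q≤j s≤k =
  d (inject₁ j) k (inject₁ q) s (subst₂ _≤_ (sym (toℕ-inject₁ q)) (sym (toℕ-inject₁ j)) q≤j) s≤k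

staircaseCode-injective : ∀ B C (S S' : Fin B → Fin C → Bool) → DownClosed S → DownClosed S' →
  staircaseCode B C S ≡ staircaseCode B C S' → ∀ j k → S j k ≡ S' j k
staircaseCode-injective zero    C       S S' d d' e () k
staircaseCode-injective (suc B) zero    S S' d d' e j ()
staircaseCode-injective (suc B) (suc C) S S' d d' e j k
  with S (fromℕ B) Fin.zero in corner | S' (fromℕ B) Fin.zero in corner'
... | true  | true  = go j k
  where
  -- the corner cell is full, hence so is the whole first column
  firstColumn : ∀ {U : Fin (suc B) → Fin (suc C) → Bool} → DownClosed U →
                U (fromℕ B) Fin.zero ≡ true → ∀ j → U j Fin.zero ≡ true
  firstColumn dU c j = dU (fromℕ B) Fin.zero j Fin.zero (≤fromℕ j) z≤n c
  go : ∀ j k → S j k ≡ S' j k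
  go j Fin.zero    = trans (firstColumn d corner j) (sym (firstColumn d' corner' j))
  go j (Fin.suc k) = staircaseCode-injective (suc B) C _ _ (dropColumn d) (dropColumn d') (∷-injectiveʳ e) j k
... | false | false = go j k
  where
  -- the corner cell is empty, hence so is the whole last row
  lastRow : ∀ {U : Fin (suc B) → Fin (suc C) → Bool} → DownClosed U →
            U (fromℕ B) Fin.zero ≡ false → ∀ k → U (fromℕ B) k ≡ false
  lastRow {U} dU c k with U (fromℕ B) k in full
  ... | false = refl
  ... | true  = trans (sym (dU (fromℕ B) k (fromℕ B) Fin.zero ≤-refl z≤n full)) c
  go : ∀ j k → S j k ≡ S' j k
  go j k with fin-last j
  ... | inj₁ refl        = trans (lastRow d corner k) (sym (lastRow d' corner' k))
  ... | inj₂ (j' , refl) = staircaseCode-injective B (suc C) _ _ (dropRow d) (dropRow d') (∷-injectiveʳ e) j' k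
... | true  | false with () ← e
... | false | true  with () ← e

allBoolLists : ℕ → List (List Bool)
allBoolLists zero    = [] ∷ []
allBoolLists (suc L) = map (true ∷_) (allBoolLists L) ++ map (false ∷_) (allBoolLists L)

length-allBoolLists : ∀ L → length (allBoolLists L) ≡ 2 ^ L
length-allBoolLists zero    = refl
length-allBoolLists (suc L) = begin
  length (map (true ∷_) (allBoolLists L) ++ map (false ∷_) (allBoolLists L))
    ≡⟨ length-++ (map (true ∷_) (allBoolLists L)) ⟩
  length (map (true ∷_) (allBoolLists L)) + length (map (false ∷_) (allBoolLists L))
    ≡⟨ cong₂ _+_ (length-map _ (allBoolLists L)) (length-map _ (allBoolLists L)) ⟩
  length (allBoolLists L) + length (allBoolLists L)
    ≡⟨ cong (λ z → z + z) (length-allBoolLists L) ⟩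
  2 ^ L + 2 ^ L
    ≡⟨ cong (2 ^ L +_) (sym (+-identityʳ (2 ^ L))) ⟩
  2 ^ L + (2 ^ L + 0) ∎
  where open ≡-Reasoning

∈-allBoolLists : ∀ (l : List Bool) L → length l ≡ L → l ∈ allBoolLists L
∈-allBoolLists []          zero    e = here refl
∈-allBoolLists (true ∷ l)  (suc L) e = ∈-++⁺ˡ (∈-map⁺ (true ∷_) (∈-allBoolLists l L (suc-injective e)))
∈-allBoolLists (false ∷ l) (suc L) e =
  ∈-++⁺ʳ (map (true ∷_) (allBoolLists L)) (∈-map⁺ (false ∷_) (∈-allBoolLists l L (suc-injective e)))

vec-ext : ∀ {A : Set} {n} (xs ys : Vec A n) → (∀ i → lookup xs i ≡ lookup ys i) → xs ≡ ys
vec-ext []       []       h = refl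
vec-ext (x ∷ xs) (y ∷ ys) h = cong₂ _∷_ (h Fin.zero) (vec-ext xs ys (λ i → h (Fin.suc i)))

-- Upper bound: for each i the slice (j, k) ↦ x i j k of a pyramid is a staircase
-- in an ℓ(μ) × ℓ(ν) box, so a pyramid is determined by ℓ(λ) paths of length
-- ℓ(μ) + ℓ(ν).
Pyr-upper : ∀ la mu nu → Pyr la mu nu ≤ (2 ^ (length mu + length nu)) ^ length la
Pyr-upper la mu nu = subst (Pyr la mu nu ≤_) count (Pyr-≤ la mu nu codes (allVec (allBoolLists (b + c)) a) inj into)
  where
  a b c : ℕ
  a = length la
  b = length mu
  c = length nu
  codes : Arr a b c → Vec (List Bool) a
  codes x = tabulate (λ i → staircaseCode b c (entry x i))
  count : length (allVec (allBoolLists (b + c)) a) ≡ (2 ^ (b + c)) ^ a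
  count = trans (length-allVec _ a) (cong (_^ a) (length-allBoolLists (b + c)))
  slice : ∀ x → IsPyramid la mu nu x → ∀ i → DownClosed (entry x i)
  slice x (_ , _ , _ , down) i j k q s = down i j k i q s ≤-refl
  inj : ∀ x y → IsPyramid la mu nu x → IsPyramid la mu nu y → codes x ≡ codes y → x ≡ y
  inj x y px py e = vec-ext x y λ i → vec-ext _ _ λ j → vec-ext _ _ λ k →
    staircaseCode-injective b c _ _ (slice x px i) (slice y py i)
      (trans (sym (lookup∘tabulate _ i)) (trans (cong (λ v → lookup v i) e) (lookup∘tabulate _ i))) j k
  into : ∀ x → IsPyramid la mu nu x → codes x ∈ allVec (allBoolLists (b + c)) a
  into x _ = ∈-allVec _ a (codes x) λ i →
    ∈-allBoolLists _ (b + c) (trans (cong length (lookup∘tabulate _ i)) (length-staircaseCode b c _))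

sumN : ℕ → (ℕ → ℕ) → ℕ
sumN zero    f = 0
sumN (suc n) f = f 0 + sumN n (λ x → f (suc x))

sumN-cong : ∀ n {f g : ℕ → ℕ} → (∀ x → x < n → f x ≡ g x) → sumN n f ≡ sumN n g
sumN-cong zero    h = refl
sumN-cong (suc n) h = cong₂ _+_ (h 0 z<s) (sumN-cong n (λ x x< → h (suc x) (s<s x<)))

sumN-mono : ∀ n {f g : ℕ → ℕ} → (∀ x → x < n → f x ≤ g x) → sumN n f ≤ sumN n g
sumN-mono zero    h = z≤n
sumN-mono (suc n) h = +-mono-≤ (h 0 z<s) (sumN-mono n (λ x x< → h (suc x) (s<s x<)))

sumN-pos : ∀ n (f : ℕ → ℕ) → 0 < n → 0 < f 0 → 0 < sumN n f
sumN-pos (suc n) f _ p = ≤-trans p (m≤m+n (f 0) _)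

sumN-split : ∀ m n (f : ℕ → ℕ) → sumN (m + n) f ≡ sumN m f + sumN n (λ x → f (m + x))
sumN-split zero    n f = refl
sumN-split (suc m) n f = trans (cong (f 0 +_) (sumN-split m n (λ x → f (suc x)))) (sym (+-assoc (f 0) _ _))

sumN-const : ∀ n c → sumN n (λ _ → c) ≡ n * c
sumN-const zero    c = refl
sumN-const (suc n) c = cong (c +_) (sumN-const n c)

sumN-+ : ∀ n (f g : ℕ → ℕ) → sumN n (λ x → f x + g x) ≡ sumN n f + sumN n g
sumN-+ zero    f g = refl
sumN-+ (suc n) f g =
  trans (cong ((f 0 + g 0) +_) (sumN-+ n (λ x → f (suc x)) (λ x → g (suc x)))) (interchange (f 0) (g 0) _ _)
  where
  interchange : ∀ a b c d → (a + b) + (c + d) ≡ (a + c) + (b + d)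
  interchange = solve-∀

sumN-const+ : ∀ n c (f : ℕ → ℕ) → sumN n (λ x → c + f x) ≡ n * c + sumN n f
sumN-const+ n c f = trans (sumN-+ n (λ _ → c) f) (cong (_+ sumN n f) (sumN-const n c))

sumN-swap : ∀ m n (f : ℕ → ℕ → ℕ) →
  sumN m (λ x → sumN n (λ y → f x y)) ≡ sumN n (λ y → sumN m (λ x → f x y))
sumN-swap zero    n f = sym (trans (sumN-const n 0) (*-zeroʳ n))
sumN-swap (suc m) n f =
  trans (cong (sumN n (λ y → f 0 y) +_) (sumN-swap m n (λ x y → f (suc x) y)))
        (sym (sumN-+ n (λ y → f 0 y) (λ y → sumN m (λ x → f (suc x) y))))

sumN-rows : ∀ Q W (f : ℕ → ℕ) → sumN Q (λ t → sumN W (λ j → f (t * W + j))) ≡ sumN (Q * W) f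
sumN-rows zero    W f = refl
sumN-rows (suc Q) W f =
  trans (cong (sumN W f +_)
          (trans (sumN-cong Q (λ t _ → sumN-cong W (λ j _ → cong f (+-assoc W (t * W) j))))
                 (sumN-rows Q W (λ x → f (W + x)))))
        (sym (sumN-split W (Q * W) f))

<ᵇ-true : ∀ {m n} → m < n → (m <ᵇ n) ≡ true
<ᵇ-true {zero}  {suc n} _       = refl
<ᵇ-true {suc m} {suc n} (s<s h) = <ᵇ-true h

<ᵇ-false : ∀ {m n} → n ≤ m → (m <ᵇ n) ≡ false
<ᵇ-false {m}     {zero}  _       = refl
<ᵇ-false {suc m} {suc n} (s≤s h) = <ᵇ-false h

<ᵇ-sound : ∀ {m n} → (m <ᵇ n) ≡ true → m < n
<ᵇ-sound {zero}  {suc n} _ = z<s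
<ᵇ-sound {suc m} {suc n} e = s<s (<ᵇ-sound e)

sumN-indicator : ∀ L P → P ≤ L → sumN L (λ x → val (x <ᵇ P)) ≡ P
sumN-indicator L       zero    _         = trans (sumN-const L 0) (*-zeroʳ L)
sumN-indicator (suc L) (suc P) (s≤s P≤L) = cong suc (sumN-indicator L P P≤L)

val≤1 : ∀ b → val b ≤ 1
val≤1 true  = ≤-refl
val≤1 false = z≤n

indicator-antitone : ∀ {x x'} y → x ≤ x' → val (x' <ᵇ y) ≤ val (x <ᵇ y)
indicator-antitone {x} {x'} y x≤x' with x' <ᵇ y in e
... | false = z≤n
... | true rewrite <ᵇ-true {x} {y} (≤-<-trans x≤x' (<ᵇ-sound e)) = ≤-refl

sumFin-cong : ∀ n {f g : Fin n → ℕ} → (∀ i → f i ≡ g i) → sumFin n f ≡ sumFin n g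
sumFin-cong zero    h = refl
sumFin-cong (suc n) h = cong₂ _+_ (h Fin.zero) (sumFin-cong n (λ i → h (Fin.suc i)))

sumFin-toℕ : ∀ n (g : ℕ → ℕ) → sumFin n (λ j → g (toℕ j)) ≡ sumN n g
sumFin-toℕ zero    g = refl
sumFin-toℕ (suc n) g = cong (g 0 +_) (sumFin-toℕ n (λ x → g (suc x)))

sumFin-toℕ² : ∀ n m (g : ℕ → ℕ → ℕ) →
  sumFin n (λ a → sumFin m (λ b → g (toℕ a) (toℕ b))) ≡ sumN n (λ a → sumN m (g a))
sumFin-toℕ² n m g = trans (sumFin-cong n (λ a → sumFin-toℕ m (g (toℕ a)))) (sumFin-toℕ n (λ a → sumN m (g a)))

tabulateList : ℕ → (ℕ → ℕ) → List ℕ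
tabulateList zero    f = []
tabulateList (suc n) f = f 0 ∷ tabulateList n (λ x → f (suc x))

length-tabulateList : ∀ n f → length (tabulateList n f) ≡ n
length-tabulateList zero    f = refl
length-tabulateList (suc n) f = cong suc (length-tabulateList n _)

lookup-tabulateList : ∀ n f (i : Fin (length (tabulateList n f))) → List.lookup (tabulateList n f) i ≡ f (toℕ i)
lookup-tabulateList (suc n) f Fin.zero    = refl
lookup-tabulateList (suc n) f (Fin.suc i) = lookup-tabulateList n _ i

tabulateList-partition : ∀ n f → (∀ x → suc x < n → f (suc x) ≤ f x) → (∀ x → x < n → 0 < f x) →
  IsPartition (sumN n f) (tabulateList n f)
tabulateList-partition n f dec pos = total n f , decreasing n f dec , positive n f pos
  where
  total : ∀ n f → sum (tabulateList n f) ≡ sumN n f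
  total zero    f = refl
  total (suc n) f = cong (f 0 +_) (total n _)
  decreasing : ∀ n f → (∀ x → suc x < n → f (suc x) ≤ f x) → Linked _≥_ (tabulateList n f)
  decreasing zero          f dec = []
  decreasing (suc zero)    f dec = [-]
  decreasing (suc (suc n)) f dec = dec 0 (s<s z<s) ∷ decreasing (suc n) _ (λ x lt → dec (suc x) (s<s lt))
  positive : ∀ n f → (∀ x → x < n → 0 < f x) → All (λ x → 0 < x) (tabulateList n f)
  positive zero    f pos = []
  positive (suc n) f pos = pos 0 z<s ∷ positive n _ (λ x lt → pos (suc x) (s<s lt))

antitone-from-steps : ∀ (f : ℕ → ℕ) B → (∀ x → suc x < B → f (suc x) ≤ f x) →
  ∀ {p} i → p ≤ i → i < B → f i ≤ f p
antitone-from-steps f B step {p} zero    z≤n _ = ≤-refl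
antitone-from-steps f B step {p} (suc i) p≤i i<B with m≤n⇒m<n∨m≡n p≤i
... | inj₂ refl       = ≤-refl
... | inj₁ (s≤s p≤i') = ≤-trans (step i i<B) (antitone-from-steps f B step i p≤i' (<-trans (n<1+n i) i<B))

lookupOr : ∀ {A : Set} {n} → Vec A n → ℕ → A → A
lookupOr []       i       d = d
lookupOr (x ∷ xs) zero    d = x
lookupOr (x ∷ xs) (suc i) d = lookupOr xs i d

lookupOr-ext : ∀ {A : Set} {n} (v w : Vec A n) d → (∀ i → i < n → lookupOr v i d ≡ lookupOr w i d) → v ≡ w
lookupOr-ext []      []       d h = refl
lookupOr-ext (x ∷ v) (y ∷ w) d h = cong₂ _∷_ (h 0 z<s) (lookupOr-ext v w d (λ i lt → h (suc i) (s<s lt)))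

-- Plane partitions in an A × M box, given by a height function h (the values
-- outside the box are irrelevant).  Their solid diagrams {(i,j,k) : k < h i j}
-- are exactly pyramids, whose three margins are the row sums, the column sums
-- and the layer sizes of h.
module PlanePartitions (A M : ℕ) where

  Antitone : (ℕ → ℕ → ℕ) → Set
  Antitone h = (∀ i j → h (suc i) j ≤ h i j) × (∀ i j → suc j < M → h i (suc j) ≤ h i j)

  antitone⇒≤ : ∀ {h} → Antitone h → ∀ {p q} i j → p ≤ i → q ≤ j → j < M → h i j ≤ h p q
  antitone⇒≤ {h} (down , right) i j p≤i q≤j j<M =
    ≤-trans (antitone-from-steps (λ x → h x j) (suc i) (λ x _ → down x j) i p≤i (n<1+n i))
            (antitone-from-steps (h _) M (right _) j q≤j j<M)

  rowSum colSum layerSize : (ℕ → ℕ → ℕ) → ℕ → ℕ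
  rowSum    h i = sumN M (h i)
  colSum    h j = sumN A (λ i → h i j)
  layerSize h k = sumN A (λ i → sumN M (λ j → val (k <ᵇ h i j)))

  volume : (ℕ → ℕ → ℕ) → ℕ
  volume h = sumN A (rowSum h)

  rows cols layers : (ℕ → ℕ → ℕ) → List ℕ
  rows   h = tabulateList A (rowSum h)
  cols   h = tabulateList M (colSum h)
  layers h = tabulateList (h 0 0) (layerSize h)

  column-height : ∀ {h} → Antitone h → ∀ {C} → h 0 0 ≤ C → ∀ i j → j < M →
    sumN C (λ k → val (k <ᵇ h i j)) ≡ h i j
  column-height anti h00≤C i j j<M =
    sumN-indicator _ _ (≤-trans (antitone⇒≤ anti i j z≤n z≤n j<M) h00≤C)

  -- The three margins of an antitone h with positive border are partitions of
  -- its volume (the layers are automatically positive up to the top layer h 0 0).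
  rows-partition : ∀ {h} → Antitone h → 0 < M → (∀ i → i < A → 0 < h i 0) →
    IsPartition (volume h) (rows h)
  rows-partition {h} (down , _) M>0 pos = tabulateList-partition A (rowSum h)
    (λ i _ → sumN-mono M (λ j _ → down i j)) (λ i i<A → sumN-pos M (h i) M>0 (pos i i<A))

  cols-partition : ∀ {h} → Antitone h → 0 < A → (∀ j → j < M → 0 < h 0 j) →
    IsPartition (volume h) (cols h)
  cols-partition {h} (_ , right) A>0 pos =
    subst (λ v → IsPartition v (cols h)) (sumN-swap M A (λ j i → h i j))
      (tabulateList-partition M (colSum h)
        (λ j j<M → sumN-mono A (λ i _ → right i j j<M)) (λ j j<M → sumN-pos A (λ i → h i j) A>0 (pos j j<M)))

  layers-partition : ∀ {h} → Antitone h → 0 < A → 0 < M → IsPartition (volume h) (layers h)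
  layers-partition {h} anti A>0 M>0 = subst (λ v → IsPartition v (layers h)) total
    (tabulateList-partition (h 0 0) (layerSize h)
      (λ k _ → sumN-mono A (λ i _ → sumN-mono M (λ j _ → indicator-antitone (h i j) (n≤1+n k))))
      (λ k k<h → sumN-pos A _ A>0 (sumN-pos M _ M>0 (subst (λ b → 0 < val b) (sym (<ᵇ-true k<h)) z<s))))
    where
    open ≡-Reasoning
    total : sumN (h 0 0) (layerSize h) ≡ volume h
    total = begin
      sumN (h 0 0) (λ k → sumN A (λ i → sumN M (λ j → val (k <ᵇ h i j))))
        ≡⟨ sumN-swap (h 0 0) A _ ⟩
      sumN A (λ i → sumN (h 0 0) (λ k → sumN M (λ j → val (k <ᵇ h i j))))
        ≡⟨ sumN-cong A (λ i _ → sumN-swap (h 0 0) M _) ⟩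
      sumN A (λ i → sumN M (λ j → sumN (h 0 0) (λ k → val (k <ᵇ h i j))))
        ≡⟨ sumN-cong A (λ i _ → sumN-cong M (λ j j<M → column-height anti ≤-refl i j j<M)) ⟩
      volume h ∎

  SameMargins : (h h₀ : ℕ → ℕ → ℕ) → Set
  SameMargins h h₀ = (∀ i → i < A → rowSum h i ≡ rowSum h₀ i) × (∀ j → j < M → colSum h j ≡ colSum h₀ j) ×
                     (∀ k → layerSize h k ≡ layerSize h₀ k)

  solid : (h₀ h : ℕ → ℕ → ℕ) → Arr (length (rows h₀)) (length (cols h₀)) (length (layers h₀))
  solid h₀ h = tabulate λ i → tabulate λ j → tabulate λ k → toℕ k <ᵇ h (toℕ i) (toℕ j)

  entry-solid : ∀ h₀ h i j k → entry (solid h₀ h) i j k ≡ (toℕ k <ᵇ h (toℕ i) (toℕ j))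
  entry-solid h₀ h i j k = trans (cong (λ z → lookup (lookup z j) k) (lookup∘tabulate _ i))
    (trans (cong (λ z → lookup z k) (lookup∘tabulate _ j)) (lookup∘tabulate _ k))

  solid-isPyramid : ∀ h₀ h → Antitone h → h 0 0 ≤ h₀ 0 0 → SameMargins h h₀ →
    IsPyramid (rows h₀) (cols h₀) (layers h₀) (solid h₀ h)
  solid-isPyramid h₀ h anti h00≤ (sameRows , sameCols , sameLayers) = rowCond , colCond , layerCond , downCond
    where
    open ≡-Reasoning
    a b c : ℕ
    a = length (rows h₀)
    b = length (cols h₀)
    c = length (layers h₀)
    a≡A : a ≡ A
    a≡A = length-tabulateList A _
    b≡M : b ≡ M
    b≡M = length-tabulateList M _
    c≡C : c ≡ h₀ 0 0
    c≡C = length-tabulateList (h₀ 0 0) _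
    inBox : ∀ (j : Fin b) → toℕ j < M
    inBox j = subst (toℕ j <_) b≡M (toℕ<n j)
    cells : ∀ i j k → val (entry (solid h₀ h) i j k) ≡ val (toℕ k <ᵇ h (toℕ i) (toℕ j))
    cells i j k = cong val (entry-solid h₀ h i j k)
    rowCond : ∀ i → sumFin b (λ j → sumFin c (λ k → val (entry (solid h₀ h) i j k))) ≡ List.lookup (rows h₀) i
    rowCond i = begin
      sumFin b (λ j → sumFin c (λ k → val (entry (solid h₀ h) i j k)))
        ≡⟨ sumFin-cong b (λ j → sumFin-cong c (cells i j)) ⟩
      sumFin b (λ j → sumFin c (λ k → val (toℕ k <ᵇ h (toℕ i) (toℕ j))))
        ≡⟨ sumFin-toℕ² b c (λ j k → val (k <ᵇ h (toℕ i) j)) ⟩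
      sumN b (λ j → sumN c (λ k → val (k <ᵇ h (toℕ i) j)))
        ≡⟨ cong₂ (λ b' c' → sumN b' (λ j → sumN c' (λ k → val (k <ᵇ h (toℕ i) j)))) b≡M c≡C ⟩
      sumN M (λ j → sumN (h₀ 0 0) (λ k → val (k <ᵇ h (toℕ i) j)))
        ≡⟨ sumN-cong M (λ j j<M → column-height anti h00≤ (toℕ i) j j<M) ⟩
      rowSum h (toℕ i)
        ≡⟨ sameRows (toℕ i) (subst (toℕ i <_) a≡A (toℕ<n i)) ⟩
      rowSum h₀ (toℕ i)
        ≡⟨ sym (lookup-tabulateList A _ i) ⟩
      List.lookup (rows h₀) i ∎
    colCond : ∀ j → sumFin a (λ i → sumFin c (λ k → val (entry (solid h₀ h) i j k))) ≡ List.lookup (cols h₀) j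
    colCond j = begin
      sumFin a (λ i → sumFin c (λ k → val (entry (solid h₀ h) i j k)))
        ≡⟨ sumFin-cong a (λ i → sumFin-cong c (cells i j)) ⟩
      sumFin a (λ i → sumFin c (λ k → val (toℕ k <ᵇ h (toℕ i) (toℕ j))))
        ≡⟨ sumFin-toℕ² a c (λ i k → val (k <ᵇ h i (toℕ j))) ⟩
      sumN a (λ i → sumN c (λ k → val (k <ᵇ h i (toℕ j))))
        ≡⟨ cong₂ (λ a' c' → sumN a' (λ i → sumN c' (λ k → val (k <ᵇ h i (toℕ j))))) a≡A c≡C ⟩
      sumN A (λ i → sumN (h₀ 0 0) (λ k → val (k <ᵇ h i (toℕ j))))
        ≡⟨ sumN-cong A (λ i _ → column-height anti h00≤ i (toℕ j) (inBox j)) ⟩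
      colSum h (toℕ j)
        ≡⟨ sameCols (toℕ j) (inBox j) ⟩
      colSum h₀ (toℕ j)
        ≡⟨ sym (lookup-tabulateList M _ j) ⟩
      List.lookup (cols h₀) j ∎
    layerCond : ∀ k → sumFin a (λ i → sumFin b (λ j → val (entry (solid h₀ h) i j k))) ≡ List.lookup (layers h₀) k
    layerCond k = begin
      sumFin a (λ i → sumFin b (λ j → val (entry (solid h₀ h) i j k)))
        ≡⟨ sumFin-cong a (λ i → sumFin-cong b (λ j → cells i j k)) ⟩
      sumFin a (λ i → sumFin b (λ j → val (toℕ k <ᵇ h (toℕ i) (toℕ j))))
        ≡⟨ sumFin-toℕ² a b (λ i j → val (toℕ k <ᵇ h i j)) ⟩
      sumN a (λ i → sumN b (λ j → val (toℕ k <ᵇ h i j)))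
        ≡⟨ cong₂ (λ a' b' → sumN a' (λ i → sumN b' (λ j → val (toℕ k <ᵇ h i j)))) a≡A b≡M ⟩
      layerSize h (toℕ k)
        ≡⟨ sameLayers (toℕ k) ⟩
      layerSize h₀ (toℕ k)
        ≡⟨ sym (lookup-tabulateList (h₀ 0 0) _ k) ⟩
      List.lookup (layers h₀) k ∎
    downCond : ∀ i j k p q s → p Fin.≤ i → q Fin.≤ j → s Fin.≤ k →
      entry (solid h₀ h) i j k ≡ true → entry (solid h₀ h) p q s ≡ true
    downCond i j k p q s p≤i q≤j s≤k full = trans (entry-solid h₀ h p q s) (<ᵇ-true
      (<-≤-trans (≤-<-trans s≤k (<ᵇ-sound (trans (sym (entry-solid h₀ h i j k)) full)))
                 (antitone⇒≤ anti (toℕ i) (toℕ j) p≤i q≤j (inBox j))))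

-- The two 3 × 3 plane partitions that are swapped inside each block:
--
--   swapBlock true:  3 3 1      swapBlock false:  3 2 2
--                    2 1 1                        3 1 0
--                    2 0 0                        1 1 0
--
-- They have the same row sums (7, 4, 2), the same column sums (7, 4, 2) and the
-- same multiset of entries, but differ in the cell (0, 1).
swapBlock : Bool → ℕ → ℕ → ℕ
swapBlock true  0 0 = 3
swapBlock true  0 1 = 3
swapBlock true  0 2 = 1
swapBlock true  1 0 = 2
swapBlock true  1 1 = 1
swapBlock true  1 2 = 1
swapBlock true  2 0 = 2
swapBlock false 0 0 = 3
swapBlock false 0 1 = 2
swapBlock false 0 2 = 2
swapBlock false 1 0 = 3
swapBlock false 1 1 = 1
swapBlock false 2 0 = 1
swapBlock false 2 1 = 1
swapBlock _     _ _ = 0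

byEval : ∀ {m n} → T (m ≤ᵇ n) → m ≤ n
byEval = ≤ᵇ⇒≤ _ _

swapBlock-down : ∀ b u v → swapBlock b (suc u) v ≤ swapBlock b u v
swapBlock-down true  0 0 = byEval tt
swapBlock-down true  0 1 = byEval tt
swapBlock-down true  0 2 = byEval tt
swapBlock-down true  1 0 = byEval tt
swapBlock-down true  1 1 = byEval tt
swapBlock-down true  1 2 = byEval tt
swapBlock-down false 0 0 = byEval tt
swapBlock-down false 0 1 = byEval tt
swapBlock-down false 0 2 = byEval tt
swapBlock-down false 1 0 = byEval tt
swapBlock-down false 1 1 = byEval tt
swapBlock-down false 1 2 = byEval tt
swapBlock-down true  0 (suc (suc (suc _))) = z≤n
swapBlock-down true  1 (suc (suc (suc _))) = z≤n
swapBlock-down false 0 (suc (suc (suc _))) = z≤n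
swapBlock-down false 1 (suc (suc (suc _))) = z≤n
swapBlock-down true  (suc (suc _)) v = z≤n
swapBlock-down false (suc (suc _)) v = z≤n

swapBlock-right : ∀ b u v → swapBlock b u (suc v) ≤ swapBlock b u v
swapBlock-right true  0 0 = byEval tt
swapBlock-right true  0 1 = byEval tt
swapBlock-right true  1 0 = byEval tt
swapBlock-right true  1 1 = byEval tt
swapBlock-right true  2 0 = byEval tt
swapBlock-right true  2 1 = byEval tt
swapBlock-right false 0 0 = byEval tt
swapBlock-right false 0 1 = byEval tt
swapBlock-right false 1 0 = byEval tt
swapBlock-right false 1 1 = byEval tt
swapBlock-right false 2 0 = byEval tt
swapBlock-right false 2 1 = byEval tt
swapBlock-right true  0 (suc (suc _)) = z≤n
swapBlock-right true  1 (suc (suc _)) = z≤n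
swapBlock-right true  2 (suc (suc _)) = z≤n
swapBlock-right false 0 (suc (suc _)) = z≤n
swapBlock-right false 1 (suc (suc _)) = z≤n
swapBlock-right false 2 (suc (suc _)) = z≤n
swapBlock-right true  (suc (suc (suc _))) v = z≤n
swapBlock-right false (suc (suc (suc _))) v = z≤n

swapBlock-corner : ∀ b → swapBlock b 0 0 ≡ 3
swapBlock-corner true  = refl
swapBlock-corner false = refl

swapBlock-≤3 : ∀ b u v → swapBlock b u v ≤ 3
swapBlock-≤3 b u v = subst (swapBlock b u v ≤_) (swapBlock-corner b)
  (≤-trans (antitone-from-steps (swapBlock b u) (suc v) (λ x _ → swapBlock-right b u x) v z≤n (n<1+n v))
           (antitone-from-steps (λ x → swapBlock b x 0) (suc u) (λ x _ → swapBlock-down b x 0) u z≤n (n<1+n u)))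

swapBlock-rowSum : ∀ b u → swapBlock b u 0 + (swapBlock b u 1 + swapBlock b u 2)
                         ≡ swapBlock true u 0 + (swapBlock true u 1 + swapBlock true u 2)
swapBlock-rowSum true  u = refl
swapBlock-rowSum false 0 = refl
swapBlock-rowSum false 1 = refl
swapBlock-rowSum false 2 = refl
swapBlock-rowSum false (suc (suc (suc _))) = refl

swapBlock-colSum : ∀ b v → swapBlock b 0 v + (swapBlock b 1 v + swapBlock b 2 v)
                         ≡ swapBlock true 0 v + (swapBlock true 1 v + swapBlock true 2 v)
swapBlock-colSum true  v = refl
swapBlock-colSum false 0 = refl
swapBlock-colSum false 1 = refl
swapBlock-colSum false 2 = refl
swapBlock-colSum false (suc (suc (suc _))) = refl

blockTotal : (ℕ → ℕ) → Bool → ℕ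
blockTotal g b = row 0 + (row 1 + row 2)
  where
  row : ℕ → ℕ
  row u = g (swapBlock b u 0) + (g (swapBlock b u 1) + g (swapBlock b u 2))

-- Both blocks have the same multiset of entries.
swapBlock-entries : ∀ g b → blockTotal g b ≡ blockTotal g true
swapBlock-entries g true  = refl
swapBlock-entries g false = permute (g 0) (g 1) (g 2) (g 3)
  where
  permute : ∀ a0 a1 a2 a3 → (a3 + (a2 + a2)) + ((a3 + (a1 + a0)) + (a1 + (a1 + a0)))
                          ≡ (a3 + (a3 + a1)) + ((a2 + (a1 + a1)) + (a2 + (a0 + a0)))
  permute = solve-∀

-- Block coordinates (x / 3, x % 3) of an index x, computed by recursion.
block : ℕ → ℕ × ℕ
block 0 = 0 , 0
block 1 = 0 , 1
block 2 = 0 , 2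
block (suc (suc (suc x))) = suc (proj₁ (block x)) , proj₂ (block x)

blockNo blockPos : ℕ → ℕ
blockNo  x = proj₁ (block x)
blockPos x = proj₂ (block x)

sumN-blocks : ∀ K (F : ℕ → ℕ → ℕ) →
  sumN (K * 3) (λ x → F (blockNo x) (blockPos x)) ≡ sumN K (λ q → F q 0 + (F q 1 + F q 2))
sumN-blocks zero    F = refl
sumN-blocks (suc K) F =
  trans (cong (λ z → F 0 0 + (F 0 1 + (F 0 2 + z))) (sumN-blocks K (λ q v → F (suc q) v)))
        (regroup (F 0 0) (F 0 1) (F 0 2) _)
  where
  regroup : ∀ a b c d → a + (b + (c + d)) ≡ (a + (b + c)) + d
  regroup = solve-∀

block-step : ∀ x → (blockNo (suc x) ≡ blockNo x × blockPos (suc x) ≡ suc (blockPos x))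
                 ⊎ (blockNo (suc x) ≡ suc (blockNo x) × blockPos (suc x) ≡ 0)
block-step 0 = inj₁ (refl , refl)
block-step 1 = inj₁ (refl , refl)
block-step 2 = inj₂ (refl , refl)
block-step (suc (suc (suc x))) with block-step x
... | inj₁ (same , next)  = inj₁ (cong suc same , next)
... | inj₂ (next , start) = inj₂ (cong suc next , start)

blockNo-< : ∀ K x → x < K * 3 → blockNo x < K
blockNo-< (suc K) 0 _ = z<s
blockNo-< (suc K) 1 _ = z<s
blockNo-< (suc K) 2 _ = z<s
blockNo-< (suc K) (suc (suc (suc x))) (s<s (s<s (s<s x<))) = s<s (blockNo-< K x x<)

block-first : ∀ q → block (q * 3) ≡ (q , 0)
block-first zero    = refl
block-first (suc q) = cong (λ b → suc (proj₁ b) , proj₂ b) (block-first q)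

block-second : ∀ q → block (suc (q * 3)) ≡ (q , 1)
block-second zero    = refl
block-second (suc q) = cong (λ b → suc (proj₁ b) , proj₂ b) (block-second q)

-- The M × M box (M = 3K) is cut into K × K blocks
-- of size 3 × 3; block (p, q) is raised by a staircase offset and then filled
-- with swapBlock (ε p q).  Each offset drops by 3 from one block to the next,
-- which absorbs the at most 3 by which swapBlock can increase across a block
-- border, so every ε : K × K → Bool gives a plane partition.
module SwapConstruction (K : ℕ) where

  M : ℕ
  M = K * 3

  offset : ℕ → ℕ
  offset p = (K ∸ suc p) * 3

  offset-step : ∀ p → suc p < K → offset p ≡ 3 + offset (suc p)
  offset-step p sp<K = cong (_* 3) (monus-step K (suc p) sp<K)
    where
    monus-step : ∀ K m → suc m ≤ K → K ∸ m ≡ suc (K ∸ suc m)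
    monus-step (suc K) zero    _         = refl
    monus-step (suc K) (suc m) (s≤s m<K) = monus-step K m m<K

  offset-≤ : ∀ p → offset p ≤ M
  offset-≤ p = *-monoˡ-≤ 3 (m∸n≤m K (suc p))

  level : Bool → ℕ → ℕ → ℕ → ℕ → ℕ
  level b p u q v = suc (offset p + (offset q + swapBlock b u v))

  level-down : ∀ (ε : ℕ → ℕ → Bool) q v {p u p' u'} → (p' ≡ p × u' ≡ suc u) ⊎ (p' ≡ suc p × u' ≡ 0 × suc p < K) →
    level (ε p' q) p' u' q v ≤ level (ε p q) p u q v
  level-down ε q v (inj₁ (refl , refl)) =
    s≤s (+-monoʳ-≤ (offset _) (+-monoʳ-≤ (offset q) (swapBlock-down (ε _ q) _ v)))
  level-down ε q v {p} {u} (inj₂ (refl , refl , sp<K)) rewrite offset-step p sp<K =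
    s≤s (≤-trans (+-monoʳ-≤ (offset (suc p)) (+-monoʳ-≤ (offset q) (swapBlock-≤3 (ε (suc p) q) 0 v)))
                 (shift (offset (suc p)) (offset q) _))
    where
    shift : ∀ a c y → a + (c + 3) ≤ (3 + a) + (c + y)
    shift a c y = subst (_≤ (3 + a) + (c + y)) (reorder a c) (+-monoʳ-≤ (3 + a) (m≤m+n c y))
      where
      reorder : ∀ a c → (3 + a) + c ≡ a + (c + 3)
      reorder = solve-∀

  level-right : ∀ (ε : ℕ → ℕ → Bool) p u {q v q' v'} → (q' ≡ q × v' ≡ suc v) ⊎ (q' ≡ suc q × v' ≡ 0 × suc q < K) →
    level (ε p q') p u q' v' ≤ level (ε p q) p u q v
  level-right ε p u (inj₁ (refl , refl)) =
    s≤s (+-monoʳ-≤ (offset p) (+-monoʳ-≤ (offset _) (swapBlock-right (ε p _) u _)))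
  level-right ε p u {q} {v} (inj₂ (refl , refl , sq<K)) rewrite offset-step q sq<K =
    s≤s (+-monoʳ-≤ (offset p) (≤-trans (+-monoʳ-≤ (offset (suc q)) (swapBlock-≤3 (ε p (suc q)) u 0))
                                       (shift (offset (suc q)) _)))
    where
    shift : ∀ c y → c + 3 ≤ (3 + c) + y
    shift c y = subst (_≤ (3 + c) + y) (+-comm 3 c) (m≤m+n (3 + c) y)

  next-index : ∀ x → suc x < M → (blockNo (suc x) ≡ blockNo x × blockPos (suc x) ≡ suc (blockPos x))
                             ⊎ (blockNo (suc x) ≡ suc (blockNo x) × blockPos (suc x) ≡ 0 × suc (blockNo x) < K)
  next-index x sx<M with block-step x
  ... | inj₁ same           = inj₁ same
  ... | inj₂ (next , start) = inj₂ (next , start , subst (_< K) next (blockNo-< K (suc x) sx<M))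

  blockLevel : (ℕ → ℕ → Bool) → ℕ → ℕ → ℕ
  blockLevel ε i j = level (ε (blockNo i) (blockNo j)) (blockNo i) (blockPos i) (blockNo j) (blockPos j)

  blockLevel-down : ∀ (ε : ℕ → ℕ → Bool) i j → suc i < M → blockLevel ε (suc i) j ≤ blockLevel ε i j
  blockLevel-down ε i j si<M = level-down ε (blockNo j) (blockPos j) (next-index i si<M)

  blockLevel-right : ∀ (ε : ℕ → ℕ → Bool) i j → suc j < M → blockLevel ε i (suc j) ≤ blockLevel ε i j
  blockLevel-right ε i j sj<M = level-right ε (blockNo i) (blockPos i) (next-index j sj<M)

  blockLevel-≤ : ∀ (ε : ℕ → ℕ → Bool) i j → blockLevel ε i j ≤ suc (M + (M + 3))
  blockLevel-≤ ε i j = s≤s (+-mono-≤ (offset-≤ _) (+-mono-≤ (offset-≤ _) (swapBlock-≤3 _ _ _)))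

  allTrue : ℕ → ℕ → Bool
  allTrue _ _ = true

  blockVolume : ℕ
  blockVolume = sumN M (λ i → sumN M (blockLevel allTrue i))

  blockVolume-≤ : blockVolume ≤ M * (M * suc (M + (M + 3)))
  blockVolume-≤ = subst (blockVolume ≤_)
    (trans (sumN-cong M (λ _ _ → sumN-const M _)) (sumN-const M _))
    (sumN-mono M (λ i _ → sumN-mono M (λ j _ → blockLevel-≤ allTrue i j)))

  sumN-blocks-cong : ∀ (F G : ℕ → ℕ → ℕ) → (∀ q → F q 0 + (F q 1 + F q 2) ≡ G q 0 + (G q 1 + G q 2)) →
    sumN M (λ x → F (blockNo x) (blockPos x)) ≡ sumN M (λ x → G (blockNo x) (blockPos x))
  sumN-blocks-cong F G same = trans (sumN-blocks K F) (trans (sumN-cong K (λ q _ → same q)) (sym (sumN-blocks K G)))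

  sum3 : (ℕ → ℕ → ℕ → ℕ → ℕ) → ℕ → ℕ → ℕ → ℕ
  sum3 F p u q = F p u q 0 + (F p u q 1 + F p u q 2)

  sumN-blocks² : ∀ (F : ℕ → ℕ → ℕ → ℕ → ℕ) →
    sumN M (λ i → sumN M (λ j → F (blockNo i) (blockPos i) (blockNo j) (blockPos j)))
      ≡ sumN K (λ p → sumN K (λ q → sum3 F p 0 q + (sum3 F p 1 q + sum3 F p 2 q)))
  sumN-blocks² F = begin
    sumN M (λ i → sumN M (λ j → F (blockNo i) (blockPos i) (blockNo j) (blockPos j)))
      ≡⟨ sumN-cong M (λ i _ → sumN-blocks K (F (blockNo i) (blockPos i))) ⟩
    sumN M (λ i → sumN K (sum3 F (blockNo i) (blockPos i)))
      ≡⟨ sumN-blocks K (λ p u → sumN K (sum3 F p u)) ⟩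
    sumN K (λ p → sumN K (sum3 F p 0) + (sumN K (sum3 F p 1) + sumN K (sum3 F p 2)))
      ≡⟨ sumN-cong K (λ p _ → sym (trans (sumN-+ K (sum3 F p 0) _) (cong (sumN K (sum3 F p 0) +_) (sumN-+ K (sum3 F p 1) (sum3 F p 2))))) ⟩
    sumN K (λ p → sumN K (λ q → sum3 F p 0 q + (sum3 F p 1 q + sum3 F p 2 q))) ∎
    where open ≡-Reasoning

  -- The full height function: the block part, lifted by t, in rows i < M, followed
  -- by Q rows of height-one cells that read the P leftover cells row by row.
  module Heights (t P Q : ℕ) where

    A : ℕ
    A = M + Q

    open PlanePartitions A M public

    padding : ℕ → ℕ → ℕ
    padding i j = val ((i ∸ M) * M + j <ᵇ P)

    height : (ℕ → ℕ → Bool) → ℕ → ℕ → ℕ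
    height ε i j = if i <ᵇ M then t + blockLevel ε i j else padding i j

    height-block : ∀ ε i j → i < M → height ε i j ≡ t + blockLevel ε i j
    height-block ε i j i<M rewrite <ᵇ-true i<M = refl

    height-padding : ∀ ε i j → M ≤ i → height ε i j ≡ padding i j
    height-padding ε i j M≤i rewrite <ᵇ-false M≤i = refl

    height-block-pos : ∀ ε i j → i < M → 0 < height ε i j
    height-block-pos ε i j i<M = subst (0 <_) (sym (height-block ε i j i<M)) (≤-trans (s≤s z≤n) (m≤n+m (blockLevel ε i j) t))

    -- Padding rows are antitone: the next row starts M cells later.
    padding-down : ∀ i j → M ≤ i → padding (suc i) j ≤ padding i j
    padding-down i j M≤i = indicator-antitone P (≤-trans (m≤n+m _ M) (≤-reflexive shifted))
      where
      shifted : M + ((i ∸ M) * M + j) ≡ (suc i ∸ M) * M + j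
      shifted = trans (sym (+-assoc M _ j)) (cong (λ z → z * M + j) (sym (+-∸-assoc 1 M≤i)))

    height-antitone : ∀ ε → Antitone (height ε)
    height-antitone ε = down , right
      where
      down : ∀ i j → height ε (suc i) j ≤ height ε i j
      down i j with suc i <? M | i <? M
      ... | yes si<M | _ rewrite height-block ε (suc i) j si<M | height-block ε i j (<-trans (n<1+n i) si<M) =
        +-monoʳ-≤ t (blockLevel-down ε i j si<M)
      ... | no si≮M | yes i<M rewrite height-padding ε (suc i) j (≮⇒≥ si≮M) =
        ≤-trans (val≤1 _) (height-block-pos ε i j i<M)
      ... | no si≮M | no i≮M rewrite height-padding ε (suc i) j (≮⇒≥ si≮M) | height-padding ε i j (≮⇒≥ i≮M) =
        padding-down i j (≮⇒≥ i≮M)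
      right : ∀ i j → suc j < M → height ε i (suc j) ≤ height ε i j
      right i j sj<M with i <? M
      ... | yes i<M rewrite height-block ε i (suc j) i<M | height-block ε i j i<M = +-monoʳ-≤ t (blockLevel-right ε i j sj<M)
      ... | no i≮M rewrite height-padding ε i (suc j) (≮⇒≥ i≮M) | height-padding ε i j (≮⇒≥ i≮M) =
        indicator-antitone P (+-monoʳ-≤ ((i ∸ M) * M) (n≤1+n j))

    spread : ∀ l a c y₀ y₁ y₂ → (l + suc (a + (c + y₀))) + ((l + suc (a + (c + y₁))) + (l + suc (a + (c + y₂))))
                              ≡ 3 * (l + suc (a + c)) + (y₀ + (y₁ + y₂))
    spread = solve-∀

    block-rowSum : ∀ b p u q → (t + level b p u q 0) + ((t + level b p u q 1) + (t + level b p u q 2))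
                             ≡ (t + level true p u q 0) + ((t + level true p u q 1) + (t + level true p u q 2))
    block-rowSum b p u q = trans (spread t (offset p) (offset q) _ _ _)
      (trans (cong (3 * (t + suc (offset p + offset q)) +_) (swapBlock-rowSum b u)) (sym (spread t (offset p) (offset q) _ _ _)))


    block-colSum : ∀ b p q v → (t + level b p 0 q v) + ((t + level b p 1 q v) + (t + level b p 2 q v))
                             ≡ (t + level true p 0 q v) + ((t + level true p 1 q v) + (t + level true p 2 q v))
    block-colSum b p q v = trans (spread t (offset p) (offset q) _ _ _)
      (trans (cong (3 * (t + suc (offset p + offset q)) +_) (swapBlock-colSum b v)) (sym (spread t (offset p) (offset q) _ _ _)))

    sumN-rows-cong : ∀ (F G : ℕ → ℕ) → sumN M F ≡ sumN M G → (∀ i → M ≤ i → F i ≡ G i) → sumN A F ≡ sumN A G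
    sumN-rows-cong F G blocks pads = trans (sumN-split M Q F)
      (trans (cong₂ _+_ blocks (sumN-cong Q (λ s _ → pads (M + s) (m≤m+n M s)))) (sym (sumN-split M Q G)))

    sameRows : ∀ ε i → i < A → rowSum (height ε) i ≡ rowSum (height allTrue) i
    sameRows ε i _ with i <? M
    ... | yes i<M = begin
      sumN M (height ε i)                  ≡⟨ sumN-cong M (λ j _ → height-block ε i j i<M) ⟩
      sumN M (λ j → t + blockLevel ε i j)
        ≡⟨ sumN-blocks-cong (λ q v → t + level (ε (blockNo i) q) (blockNo i) (blockPos i) q v)
                            (λ q v → t + level true (blockNo i) (blockPos i) q v)
                            (λ q → block-rowSum (ε (blockNo i) q) (blockNo i) (blockPos i) q) ⟩
      sumN M (λ j → t + blockLevel allTrue i j) ≡⟨ sumN-cong M (λ j _ → sym (height-block allTrue i j i<M)) ⟩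
      sumN M (height allTrue i)            ∎
      where open ≡-Reasoning
    ... | no i≮M = sumN-cong M (λ j _ →
      trans (height-padding ε i j (≮⇒≥ i≮M)) (sym (height-padding allTrue i j (≮⇒≥ i≮M))))

    sameCols : ∀ ε j → j < M → colSum (height ε) j ≡ colSum (height allTrue) j
    sameCols ε j _ = sumN-rows-cong _ _ (begin
      sumN M (λ i → height ε i j)            ≡⟨ sumN-cong M (λ i i<M → height-block ε i j i<M) ⟩
      sumN M (λ i → t + blockLevel ε i j)
        ≡⟨ sumN-blocks-cong (λ p u → t + level (ε p (blockNo j)) p u (blockNo j) (blockPos j))
                            (λ p u → t + level true p u (blockNo j) (blockPos j))
                            (λ p → block-colSum (ε p (blockNo j)) p (blockNo j) (blockPos j)) ⟩
      sumN M (λ i → t + blockLevel allTrue i j) ≡⟨ sumN-cong M (λ i i<M → sym (height-block allTrue i j i<M)) ⟩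
      sumN M (λ i → height allTrue i j)      ∎)
      (λ i M≤i → trans (height-padding ε i j M≤i) (sym (height-padding allTrue i j M≤i)))
      where open ≡-Reasoning

    -- The layer count of a block only sees the multiset of its entries.
    layerCount : ∀ (ε' : ℕ → ℕ → Bool) k → sumN M (λ i → sumN M (λ j → val (k <ᵇ height ε' i j)))
      ≡ sumN K (λ p → sumN K (λ q → blockTotal (λ y → val (k <ᵇ t + suc (offset p + (offset q + y)))) (ε' p q)))
    layerCount ε' k = trans
      (sumN-cong M (λ i i<M → sumN-cong M (λ j _ → cong (λ z → val (k <ᵇ z)) (height-block ε' i j i<M))))
      (sumN-blocks² (λ p u q v → val (k <ᵇ t + level (ε' p q) p u q v)))

    sameLayers : ∀ ε k → layerSize (height ε) k ≡ layerSize (height allTrue) k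
    sameLayers ε k = sumN-rows-cong _ _
      (trans (layerCount ε k) (trans
        (sumN-cong K (λ p _ → sumN-cong K (λ q _ → swapBlock-entries (λ y → val (k <ᵇ t + suc (offset p + (offset q + y)))) (ε p q))))
        (sym (layerCount allTrue k))))
      (λ i M≤i → sumN-cong M (λ j _ → cong (λ z → val (k <ᵇ z))
        (trans (height-padding ε i j M≤i) (sym (height-padding allTrue i j M≤i)))))

    sameMargins : ∀ ε → SameMargins (height ε) (height allTrue)
    sameMargins ε = sameRows ε , sameCols ε , sameLayers ε

    corner : ℕ
    corner = t + suc (offset 0 + (offset 0 + 3))

    height-corner : ∀ ε → 0 < K → height ε 0 0 ≡ corner
    height-corner ε K>0 = trans (height-block ε 0 0 (*-monoˡ-< 3 K>0))
      (cong (λ y → t + suc (offset 0 + (offset 0 + y))) (swapBlock-corner (ε 0 0)))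

    la₀ mu₀ nu₀ : List ℕ
    la₀ = rows   (height allTrue)
    mu₀ = cols   (height allTrue)
    nu₀ = layers (height allTrue)

    volume-formula : P ≤ Q * M → volume (height allTrue) ≡ M * (M * t) + blockVolume + P
    volume-formula P≤QM = trans (sumN-split M Q _) (cong₂ _+_ blockPart paddingPart)
      where
      blockPart : sumN M (rowSum (height allTrue)) ≡ M * (M * t) + blockVolume
      blockPart = trans (sumN-cong M (λ i i<M → trans (sumN-cong M (λ j _ → height-block allTrue i j i<M))
                                                      (sumN-const+ M t _)))
                        (sumN-const+ M (M * t) _)
      paddingPart : sumN Q (λ s → rowSum (height allTrue) (M + s)) ≡ P
      paddingPart = trans
        (sumN-cong Q (λ s _ → sumN-cong M (λ j _ → trans (height-padding allTrue (M + s) j (m≤m+n M s))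
                                                         (cong (λ z → val (z * M + j <ᵇ P)) (m+n∸m≡n M s)))))
        (trans (sumN-rows Q M (λ x → val (x <ᵇ P))) (sumN-indicator (Q * M) P P≤QM))

    margins-partitions : 0 < K → (∀ s → s < Q → s * M < P) →
      IsPartition (volume (height allTrue)) la₀ × IsPartition (volume (height allTrue)) mu₀ ×
      IsPartition (volume (height allTrue)) nu₀
    margins-partitions K>0 paddingRows =
      rows-partition anti M>0 rowStart , cols-partition anti A>0 colStart , layers-partition anti A>0 M>0
      where
      anti : Antitone (height allTrue)
      anti = height-antitone allTrue
      M>0 : 0 < M
      M>0 = *-monoˡ-< 3 K>0
      A>0 : 0 < A
      A>0 = ≤-trans M>0 (m≤m+n M Q)
      rowStart : ∀ i → i < A → 0 < height allTrue i 0
      rowStart i i<A with i <? M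
      ... | yes i<M = height-block-pos allTrue i 0 i<M
      ... | no  i≮M = subst (0 <_) (sym (height-padding allTrue i 0 (≮⇒≥ i≮M)))
        (subst (λ b → 0 < val b) (sym (<ᵇ-true (subst (_< P) (sym (+-identityʳ _)) (paddingRows (i ∸ M) s<Q)))) z<s)
        where
        s<Q : i ∸ M < Q
        s<Q = +-cancelˡ-< M _ _ (subst (_< M + Q) (sym (m+[n∸m]≡n (≮⇒≥ i≮M))) i<A)
      colStart : ∀ j → j < M → 0 < height allTrue 0 j
      colStart j _ = height-block-pos allTrue 0 j M>0

    probeLayer : ℕ → ℕ → ℕ
    probeLayer p q = t + suc (offset p + (offset q + 2))


    probe : ∀ ε p q → p < K → (probeLayer p q <ᵇ height ε (p * 3) (suc (q * 3))) ≡ ε p q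
    probe ε p q p<K = trans (cong (probeLayer p q <ᵇ_) (trans (height-block ε _ _ (*-monoˡ-< 3 p<K))
        (cong₂ (λ bi bj → t + level (ε (proj₁ bi) (proj₁ bj)) (proj₁ bi) (proj₂ bi) (proj₁ bj) (proj₂ bj))
               (block-first p) (block-second q))))
      (reads (ε p q))
      where
      reads : ∀ b → (probeLayer p q <ᵇ t + suc (offset p + (offset q + swapBlock b 0 1))) ≡ b
      reads true  = <ᵇ-true (+-monoʳ-< t (s<s (+-monoʳ-< (offset p) (+-monoʳ-< (offset q) (n<1+n 2)))))
      reads false = <ᵇ-false {probeLayer p q} ≤-refl

    patternOf : Vec (Vec Bool K) K → ℕ → ℕ → Bool
    patternOf v p q = lookupOr (lookupOr v p (Vec.replicate K true)) q true

    pyramidOf : Vec (Vec Bool K) K → Arr (length la₀) (length mu₀) (length nu₀)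
    pyramidOf v = solid (height allTrue) (height (patternOf v))

    pyramidOf-isPyramid : 0 < K → ∀ v → IsPyramid la₀ mu₀ nu₀ (pyramidOf v)
    pyramidOf-isPyramid K>0 v = solid-isPyramid (height allTrue) (height ε) (height-antitone ε)
      (≤-reflexive (trans (height-corner ε K>0) (sym (height-corner allTrue K>0)))) (sameMargins ε)
      where
      ε : ℕ → ℕ → Bool
      ε = patternOf v

    probeColumn< : ∀ {q} → q < K → suc (q * 3) < M
    probeColumn< {q} q<K = ≤-trans (s≤s (s≤s (n≤1+n (q * 3)))) (*-monoˡ-≤ 3 q<K)

    probeRow<ℓ : ∀ {p} → p < K → p * 3 < length la₀
    probeRow<ℓ p<K = subst (_ <_) (sym (length-tabulateList A _)) (≤-trans (*-monoˡ-< 3 p<K) (m≤m+n M Q))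

    probeColumn<ℓ : ∀ {q} → q < K → suc (q * 3) < length mu₀
    probeColumn<ℓ q<K = subst (_ <_) (sym (length-tabulateList M _)) (probeColumn< q<K)

    probeLayer<ℓ : ∀ {p q} → p < K → q < K → probeLayer p q < length nu₀
    probeLayer<ℓ {p} {q} p<K q<K = subst (_ <_) (sym (length-tabulateList _ _))
      (<-≤-trans (<ᵇ-sound (probe allTrue p q p<K))
                 (antitone⇒≤ (height-antitone allTrue) _ _ z≤n z≤n (probeColumn< q<K)))

    probeCell : ∀ v p q (p<K : p < K) (q<K : q < K) →
      entry (pyramidOf v) (fromℕ< (probeRow<ℓ p<K)) (fromℕ< (probeColumn<ℓ q<K)) (fromℕ< (probeLayer<ℓ p<K q<K))
        ≡ patternOf v p q
    probeCell v p q p<K q<K = trans (entry-solid (height allTrue) (height (patternOf v)) _ _ _)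
      (trans (cong₂ _<ᵇ_ (toℕ-fromℕ< _) (cong₂ (height (patternOf v)) (toℕ-fromℕ< _) (toℕ-fromℕ< _)))
             (probe (patternOf v) p q p<K))

    pyramidOf-injective : ∀ {v w} → pyramidOf v ≡ pyramidOf w → v ≡ w
    pyramidOf-injective {v} {w} same = lookupOr-ext v w _ λ p p<K → lookupOr-ext _ _ true λ q q<K →
      trans (sym (probeCell v p q p<K q<K)) (trans (cong (λ x → entry x _ _ _) same) (probeCell w p q p<K q<K))

    Pyr-lower : 0 < K → (2 ^ K) ^ K ≤ Pyr la₀ mu₀ nu₀
    Pyr-lower K>0 = subst (_≤ Pyr la₀ mu₀ nu₀) (trans (length-allVec _ K) (cong (_^ K) (length-allVec bools K)))
      (Pyr-≥ la₀ mu₀ nu₀ pyramidOf (allVec (allVec bools K) K) (allVec-unique _ K (allVec-unique _ K bools-unique))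
        pyramidOf-injective (pyramidOf-isPyramid K>0))

    Pyr-upper-construction : 0 < K → Pyr la₀ mu₀ nu₀ ≤ (2 ^ (M + corner)) ^ A
    Pyr-upper-construction K>0 = subst (Pyr la₀ mu₀ nu₀ ≤_)
      (cong₂ (λ a z → (2 ^ z) ^ a) (length-tabulateList A _)
        (cong₂ _+_ (length-tabulateList M _) (trans (length-tabulateList _ _) (height-corner allTrue K>0))))
      (Pyr-upper la₀ mu₀ nu₀)

cube≡ : ∀ x → x ^ 3 ≡ x * (x * x)
cube≡ x = cong (λ z → x * (x * z)) (*-identityʳ x)

square≡ : ∀ x → x ^ 2 ≡ x * x
square≡ x = cong (x *_) (*-identityʳ x)

cube-reflects-≤ : ∀ {x y} → x ^ 3 ≤ y ^ 3 → x ≤ y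
cube-reflects-≤ {x} {y} x³≤y³ with x ≤? y
... | yes x≤y = x≤y
... | no  x≰y = ⊥-elim (<⇒≱ (^-monoˡ-< 3 (≰⇒> x≰y)) x³≤y³)

cubeRoot91 : ∀ n → Σ ℕ λ K → 91 * K ^ 3 ≤ n × n < 91 * suc K ^ 3
cubeRoot91 zero = 0 , z≤n , s≤s z≤n
cubeRoot91 (suc n) with cubeRoot91 n
... | K , lo , hi with suc n <? 91 * suc K ^ 3
...   | yes below = K , ≤-trans lo (n≤1+n n) , below
...   | no  above = suc K , ≤-reflexive reached ,
                    subst (_< 91 * suc (suc K) ^ 3) reached (*-monoʳ-< 91 (^-monoˡ-< 3 (n<1+n (suc K))))
  where
  reached : 91 * suc K ^ 3 ≡ suc n
  reached = sym (≤-antisym hi (≮⇒≥ above))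

exponent-lower : ∀ K n m → n < 729 * K ^ 3 → (81 * m) ^ 3 ≤ n ^ 2 → m ≤ K * K
exponent-lower K n m n<729K³ hyp with m ≤? K * K
... | yes m≤K² = m≤K²
... | no  m≰K² = ⊥-elim (<⇒≱ (<-≤-trans n²< (^-monoˡ-≤ 3 (*-monoʳ-≤ 81 (<⇒≤ (≰⇒> m≰K²))))) hyp)
  where
  n²< : n ^ 2 < (81 * (K * K)) ^ 3
  n²< = <-≤-trans (^-monoˡ-< 2 n<729K³) (≤-reflexive (square K))
    where
    square : ∀ x → (729 * x ^ 3) ^ 2 ≡ (81 * (x * x)) ^ 3
    square x = trans (square≡ (729 * x ^ 3)) (trans (cong (λ c → (729 * c) * (729 * c)) (cube≡ x))
                     (trans (poly x) (sym (cube≡ (81 * (x * x))))))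
      where
      poly : ∀ x → (729 * (x * (x * x))) * (729 * (x * (x * x))) ≡ (81 * (x * x)) * ((81 * (x * x)) * (81 * (x * x)))
      poly = solve-∀

exponent-upper : ∀ b K n m → K ^ 3 ≤ n → b ^ 3 * n ^ 2 ≤ m ^ 3 → b * (K * K) ≤ m
exponent-upper b K n m K³≤n hyp = cube-reflects-≤ (begin
  (b * (K * K)) ^ 3   ≡⟨ expand b K ⟩
  b ^ 3 * (K ^ 3) ^ 2 ≤⟨ *-monoʳ-≤ (b ^ 3) (^-monoˡ-≤ 2 K³≤n) ⟩
  b ^ 3 * n ^ 2       ≤⟨ hyp ⟩
  m ^ 3               ∎)
  where
  open ≤-Reasoning
  expand : ∀ c x → (c * (x * x)) ^ 3 ≡ c ^ 3 * (x ^ 3) ^ 2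
  expand c x = trans (cube≡ (c * (x * x))) (trans (poly c x)
    (sym (cong₂ _*_ (cube≡ c) (trans (square≡ (x ^ 3)) (cong (λ z → z * z) (cube≡ x))))))
    where
    poly : ∀ c x → (c * (x * x)) * ((c * (x * x)) * (c * (x * x))) ≡ (c * (c * c)) * ((x * (x * x)) * (x * (x * x)))
    poly = solve-∀

-- Writing w = (w / M) M + w % M: the P = w + 1 padding cells fill Q = w / M + 1
-- rows of length M, and each of these rows gets at least one cell.
padding-fits : ∀ w M .{{_ : NonZero M}} → suc w ≤ suc (w / M) * M
padding-fits w M = subst (_≤ suc (w / M) * M) (cong suc (sym (m≡m%n+[m/n]*n w M))) (+-monoˡ-≤ ((w / M) * M) (m%n<n w M))


padding-rows : ∀ w M .{{_ : NonZero M}} → ∀ s → s < suc (w / M) → s * M < suc w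
padding-rows w M s s<Q = s≤s (≤-trans (*-monoˡ-≤ M (≤-pred s<Q)) (m/n*n≤m w M))

blockVolume-< : ∀ k → suc (SwapConstruction.blockVolume (suc k)) ≤ 91 * suc k ^ 3
blockVolume-< k = begin
  suc blockVolume                 ≤⟨ s≤s blockVolume-≤ ⟩
  suc bound                       ≤⟨ subst (_≤ bound + slack) (+-comm bound 1) (+-monoʳ-≤ bound slack≥1) ⟩
  bound + slack                   ≡⟨ sym (poly k) ⟩
  91 * (suc k * (suc k * suc k))  ≡⟨ cong (91 *_) (sym (cube≡ (suc k))) ⟩
  91 * suc k ^ 3                  ∎
  where
  open ≤-Reasoning
  open SwapConstruction (suc k)
  bound slack : ℕ
  bound = M * (M * suc (M + (M + 3)))
  slack = (suc k * suc k) * (37 * k + 1)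
  slack≥1 : 1 ≤ slack
  slack≥1 = *-mono-≤ {1} {suc k * suc k} (s≤s z≤n) (m≤n+m 1 (37 * k))
  poly : ∀ k → 91 * ((1 + k) * ((1 + k) * (1 + k)))
             ≡ ((1 + k) * 3) * (((1 + k) * 3) * (1 + (((1 + k) * 3) + (((1 + k) * 3) + 3)))) + ((1 + k) * (1 + k)) * (37 * k + 1)
  poly = solve-∀

-- Below 91 (K + 2)³ is below 729 (K + 1)³, as K + 2 ≤ 2 (K + 1).
below-729 : ∀ k n → n < 91 * suc (suc k) ^ 3 → n < 729 * suc k ^ 3
below-729 k n hi = <-≤-trans hi (begin
  91 * suc K ^ 3       ≤⟨ *-monoʳ-≤ 91 (^-monoˡ-≤ 3 sK≤2K) ⟩
  91 * (2 * K) ^ 3     ≡⟨ cong (91 *_) (trans (cube≡ (2 * K)) (trans (eight K) (cong (8 *_) (sym (cube≡ K))))) ⟩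
  91 * (8 * K ^ 3)     ≡⟨ sym (*-assoc 91 8 (K ^ 3)) ⟩
  728 * K ^ 3          ≤⟨ m≤n+m (728 * K ^ 3) (K ^ 3) ⟩
  729 * K ^ 3          ∎)
  where
  open ≤-Reasoning
  K : ℕ
  K = suc k
  sK≤2K : suc K ≤ 2 * K
  sK≤2K = ≤-trans (+-monoˡ-≤ K (s≤s z≤n)) (≤-reflexive (cong (K +_) (sym (+-identityʳ K))))
  eight : ∀ x → (2 * x) * ((2 * x) * (2 * x)) ≡ 8 * (x * (x * x))
  eight = solve-∀

Witness : ℕ → Set
Witness n = Σ (List ℕ) λ la → Σ (List ℕ) λ mu → Σ (List ℕ) λ nu →
  IsPartition n la × IsPartition n mu × IsPartition n nu ×
  (∀ m → (81 * m) ^ 3 ≤ n ^ 2 → 2 ^ m ≤ Pyr la mu nu) ×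
  (∀ m → 564 ^ 3 * n ^ 2 ≤ m ^ 3 → Pyr la mu nu ≤ 2 ^ m)

-- For 91 K³ ≤ n < 91 (K + 1)³ with K ≥ 1, the construction with K × K blocks,
-- lifted by t = R / M² and padded by P = R % M² + 1 cells (R = n - blockVolume - 1),
-- has volume n, and 2^(K²) ≤ Pyr ≤ 2^(564 K²).
pyramidsOfSize : ∀ n k → 91 * suc k ^ 3 ≤ n → n < 91 * suc (suc k) ^ 3 → Witness n
pyramidsOfSize n k lo hi =
  la₀ , mu₀ , nu₀ , proj₁ partitions , proj₁ (proj₂ partitions) , proj₂ (proj₂ partitions) , lower , upper
  where
  K : ℕ
  K = suc k
  open SwapConstruction K
  R t w : ℕ
  R = n ∸ suc blockVolume
  t = R / (M * M)
  w = R % (M * M)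
  open Heights t (suc w) (suc (w / M))

  n<729K³ : n < 729 * K ^ 3
  n<729K³ = below-729 k n hi

  volume≡n : volume (height allTrue) ≡ n
  volume≡n = begin
    volume (height allTrue)                   ≡⟨ volume-formula (padding-fits w M) ⟩
    M * (M * t) + blockVolume + suc w         ≡⟨ regroup M t blockVolume w ⟩
    suc blockVolume + (w + t * (M * M))       ≡⟨ cong (suc blockVolume +_) (sym (m≡m%n+[m/n]*n R (M * M))) ⟩
    suc blockVolume + R                       ≡⟨ m+[n∸m]≡n (≤-trans (blockVolume-< k) lo) ⟩
    n                                         ∎
    where
    open ≡-Reasoning
    regroup : ∀ M t G w → M * (M * t) + G + suc w ≡ suc G + (w + t * (M * M))
    regroup = solve-∀

  partitions : IsPartition n la₀ × IsPartition n mu₀ × IsPartition n nu₀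
  partitions = subst (λ v → IsPartition v la₀ × IsPartition v mu₀ × IsPartition v nu₀) volume≡n
    (margins-partitions z<s (padding-rows w M))

  lower : ∀ m → (81 * m) ^ 3 ≤ n ^ 2 → 2 ^ m ≤ Pyr la₀ mu₀ nu₀
  lower m hyp = ≤-trans (^-monoʳ-≤ 2 (exponent-lower K n m n<729K³ hyp))
                        (subst (_≤ Pyr la₀ mu₀ nu₀) (^-*-assoc 2 K K) (Pyr-lower z<s))

  -- The lift is t ≤ n / M² < 81 K.
  t≤81K : t ≤ 81 * K
  t≤81K = <⇒≤ (*-cancelʳ-< (M * M) t (81 * K) (begin-strict
    t * (M * M)     ≤⟨ m/n*n≤m R (M * M) ⟩
    R               ≤⟨ m∸n≤m n (suc blockVolume) ⟩
    n               <⟨ n<729K³ ⟩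
    729 * K ^ 3     ≡⟨ trans (cong (729 *_) (cube≡ K)) (poly K) ⟩
    81 * K * (M * M) ∎))
    where
    open ≤-Reasoning
    poly : ∀ K → 729 * (K * (K * K)) ≡ 81 * K * ((K * 3) * (K * 3))
    poly = solve-∀

  -- The exponent of the upper bound: (M + corner) A ≤ 94 K · 6 K = 564 K².
  exponent : (M + corner) * A ≤ 564 * (K * K)
  exponent = begin
    (M + corner) * A     ≤⟨ *-mono-≤ sides A≤2M ⟩
    (94 * K) * (M + M)   ≡⟨ poly₂ K ⟩
    564 * (K * K)        ∎
    where
    open ≤-Reasoning
    poly₁ : ∀ K → K * 3 + (81 * K + suc (K * 3 + (K * 3 + 3))) ≡ 90 * K + 4
    poly₁ = solve-∀
    poly₂ : ∀ K → (94 * K) * (K * 3 + K * 3) ≡ 564 * (K * K)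
    poly₂ = solve-∀
    sides : M + corner ≤ 94 * K
    sides = begin
      M + corner                                  ≤⟨ +-monoʳ-≤ M (+-mono-≤ t≤81K (s≤s (+-mono-≤ (offset-≤ 0) (+-monoˡ-≤ 3 (offset-≤ 0))))) ⟩
      M + (81 * K + suc (M + (M + 3)))            ≡⟨ poly₁ K ⟩
      90 * K + 4                                  ≤⟨ +-monoʳ-≤ (90 * K) (*-monoʳ-≤ 4 (s≤s z≤n)) ⟩
      90 * K + 4 * K                              ≡⟨ sym (*-distribʳ-+ K 90 4) ⟩
      94 * K                                      ∎
    A≤2M : A ≤ M + M
    A≤2M = +-monoʳ-≤ M (m<n*o⇒m/o<n {w} {M} {M} (m%n<n R (M * M)))

  upper : ∀ m → 564 ^ 3 * n ^ 2 ≤ m ^ 3 → Pyr la₀ mu₀ nu₀ ≤ 2 ^ m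
  upper m hyp = begin
    Pyr la₀ mu₀ nu₀           ≤⟨ Pyr-upper-construction z<s ⟩
    (2 ^ (M + corner)) ^ A    ≡⟨ ^-*-assoc 2 (M + corner) A ⟩
    2 ^ ((M + corner) * A)    ≤⟨ ^-monoʳ-≤ 2 (≤-trans exponent (exponent-upper 564 K n m K³≤n hyp)) ⟩
    2 ^ m                     ∎
    where
    open ≤-Reasoning
    K³≤n : K ^ 3 ≤ n
    K³≤n = ≤-trans (m≤n*m (K ^ 3) 91) lo

proposition9p5 :
  Σ ℕ λ a → Σ ℕ λ b → (1 ≤ a) × (1 ≤ b) × Σ ℕ λ N → ∀ n → N ≤ n →
    Σ (List ℕ) λ la → Σ (List ℕ) λ mu → Σ (List ℕ) λ nu →
      IsPartition n la × IsPartition n mu × IsPartition n nu ×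
      (∀ m → (a * m) ^ 3 ≤ n ^ 2 → 2 ^ m ≤ Pyr la mu nu) ×
      (∀ m → b ^ 3 * n ^ 2 ≤ m ^ 3 → Pyr la mu nu ≤ 2 ^ m)
proposition9p5 = 81 , 564 , s≤s z≤n , s≤s z≤n , 91 , witness
  where
  -- Choose K with 91 K³ ≤ n < 91 (K + 1)³; then K ≥ 1 because n ≥ 91.
  witness : ∀ n → 91 ≤ n → Witness n
  witness n 91≤n = fromRoot (cubeRoot91 n)
    where
    fromRoot : (Σ ℕ λ K → 91 * K ^ 3 ≤ n × n < 91 * suc K ^ 3) → Witness n
    fromRoot (zero  , _  , n<91) = ⊥-elim (<⇒≱ n<91 91≤n)
    fromRoot (suc k , lo , hi)   = pyramidsOfSize n k lo hi
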